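{- Let $F:\mathbf{Sets}\to\mathbf{Sets}$ be a functor, $A$ a set, and $\sqsubseteq$ an order on $F^A$ with $\sqsubseteq=\prod_{a\in A}\sqsubseteq^a$ for a family of orders $\sqsubseteq^a$ on $F$. If every $\sqsubseteq^a$ is stable, then $\sqsubseteq$ is stable.
   Context: $F^A$ is the functor $X\mapsto(FX)^A$ with $F^Af(\alpha)(a)=Ff(\alpha(a))$. An order on a functor $G$ is a family of preorders $\sqsubseteq_X\subseteq GX\times GX$ with $u\sqsubseteq_X u'\Rightarrow Gf(u)\sqsubseteq_Y Gf(u')$ for all $f:X\to Y$. $\sqsubseteq=\prod_a\sqsubseteq^a$ means $f\sqsubseteq_X g$ iff $f(a)\sqsubseteq^a_X g(a)$ for all $a\in A$. For $R\subseteq X_1\times X_2$ with projections $r_1,r_2$: $\mathrm{Rel}(G)(R)=\{(u,v)\mid\exists w\in G(R).\,Gr_1(w)=u,\ Gr_2(w)=v\}$ and $\mathrm{Rel}_{\sqsubseteq}(G)(R)=\{(u,v)\mid\exists w\in G(R).\,u\sqsubseteq_{X_1}Gr_1(w)\wedge Gr_2(w)\sqsubseteq_{X_2}v\}$. An order $\sqsubseteq$ on $G$ is stable if for all $f:X\to Z$, $g:Y\to W$, $R\subseteq Z\times W$: $\mathrm{Rel}_{\sqsubseteq}(G)((f\times g)^{ -1}(R))=(Gf\times Gg)^{ -1}(\mathrm{Rel}_{\sqsubseteq}(G)(R))$, where $(f\times g)^{ -1}(R)=\{(x,y)\mid(f(x),g(y))\in R\}$. -}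

module Defs where

open import Data.Product using (Σ; _×_; _,_; proj₁; proj₂)
open import Function using (_∘_; id)
open import Relation.Binary.PropositionalEquality using (_≡_)

record RawFunctor : Set₁ where
  field
    F₀ : Set → Set
    F₁ : ∀ {X Y : Set} → (X → Y) → F₀ X → F₀ Y

record Functor : Set₁ where
  field
    raw  : RawFunctor
  open RawFunctor raw public
  field
    F-id : ∀ {X : Set} (u : F₀ X) → F₁ id u ≡ u
    F-∘  : ∀ {X Y Z : Set} (f : X → Y) (g : Y → Z) (u : F₀ X) →
           F₁ (g ∘ f) u ≡ F₁ g (F₁ f u)

Exp : Functor → Set → RawFunctor
Exp F A = record
  { F₀ = λ X → A → Functor.F₀ F X
  ; F₁ = λ f α a → Functor.F₁ F f (α a)
  }

record Order (G : RawFunctor) : Set₁ where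
  open RawFunctor G
  field
    _⊑_     : ∀ {X : Set} → F₀ X → F₀ X → Set
    ⊑-refl  : ∀ {X : Set} (u : F₀ X) → u ⊑ u
    ⊑-trans : ∀ {X : Set} {u v w : F₀ X} → u ⊑ v → v ⊑ w → u ⊑ w
    ⊑-mono  : ∀ {X Y : Set} (f : X → Y) {u u' : F₀ X} →
              u ⊑ u' → F₁ f u ⊑ F₁ f u'

-- A relation R ⊆ X₁ × X₂ is a predicate on pairs; the set R as a type:
Graph : {X₁ X₂ : Set} → (X₁ → X₂ → Set) → Set
Graph {X₁} {X₂} R = Σ (X₁ × X₂) (λ p → R (proj₁ p) (proj₂ p))

Rel⊑ : {G : RawFunctor} → Order G → {X₁ X₂ : Set} → (X₁ → X₂ → Set) →
       RawFunctor.F₀ G X₁ → RawFunctor.F₀ G X₂ → Set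
Rel⊑ {G} O R u v =
  Σ (F₀ (Graph R)) λ w →
    (u ⊑ F₁ (proj₁ ∘ proj₁) w) × (F₁ (proj₂ ∘ proj₁) w ⊑ v)
  where open RawFunctor G
        open Order O

preimage : {X Y Z W : Set} → (X → Z) → (Y → W) → (Z → W → Set) → X → Y → Set
preimage f g R x y = R (f x) (g y)

Stable : {G : RawFunctor} → Order G → Set₁
Stable {G} O =
  ∀ {X Y Z W : Set} (f : X → Z) (g : Y → W) (R : Z → W → Set)
    (u : F₀ X) (v : F₀ Y) →
    (Rel⊑ O (preimage f g R) u v → Rel⊑ O R (F₁ f u) (F₁ g v)) ×
    (Rel⊑ O R (F₁ f u) (F₁ g v) → Rel⊑ O (preimage f g R) u v)
  where open RawFunctor G

{-# OPTIONS --safe #-}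
module Submission where

open import Defs
open import Data.Product using (_×_; _,_; proj₁; proj₂)

-- A witness in F^A(R) = (F R)^A is just an A-indexed family of witnesses in
-- F R, so for a product order Rel_⊑(F^A)(R) relates u and v exactly when every
-- Rel_⊑^a(F)(R) relates u a and v a.  Both sides of the stability equation
-- therefore split into components, where they agree by stability of each ⊑^a.

IsProductOrder : (F : Functor) (A : Set) →
  (A → Order (Functor.raw F)) → Order (Exp F A) → Set₁
IsProductOrder F A O P =
  ∀ {X : Set} (α β : A → Functor.F₀ F X) →
    (Order._⊑_ P α β → ∀ a → Order._⊑_ (O a) (α a) (β a)) ×
    ((∀ a → Order._⊑_ (O a) (α a) (β a)) → Order._⊑_ P α β)

module _ (F : Functor) (A : Set)
         (O : A → Order (Functor.raw F)) (P : Order (Exp F A))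
         (product : IsProductOrder F A O P) where

  Rel⊑-split : ∀ {X₁ X₂ : Set} (R : X₁ → X₂ → Set) u v →
    Rel⊑ P R u v → ∀ a → Rel⊑ (O a) R (u a) (v a)
  Rel⊑-split R u v (w , u⊑w₁ , w₂⊑v) a =
    w a , proj₁ (product _ _) u⊑w₁ a , proj₁ (product _ _) w₂⊑v a

  Rel⊑-merge : ∀ {X₁ X₂ : Set} (R : X₁ → X₂ → Set) u v →
    (∀ a → Rel⊑ (O a) R (u a) (v a)) → Rel⊑ P R u v
  Rel⊑-merge R u v r =
      (λ a → proj₁ (r a))
    , proj₂ (product _ _) (λ a → proj₁ (proj₂ (r a)))
    , proj₂ (product _ _) (λ a → proj₂ (proj₂ (r a)))

  stable-product : (∀ a → Stable (O a)) → Stable P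
  stable-product stable f g R u v = preimage⇒image , image⇒preimage
    where
    preimage⇒image : Rel⊑ P (preimage f g R) u v →
                     Rel⊑ P R (λ a → Functor.F₁ F f (u a)) (λ a → Functor.F₁ F g (v a))
    preimage⇒image r = Rel⊑-merge R _ _ λ a →
      proj₁ (stable a f g R (u a) (v a)) (Rel⊑-split (preimage f g R) u v r a)

    image⇒preimage : Rel⊑ P R (λ a → Functor.F₁ F f (u a)) (λ a → Functor.F₁ F g (v a)) →
                     Rel⊑ P (preimage f g R) u v
    image⇒preimage r = Rel⊑-merge (preimage f g R) u v λ a →
      proj₂ (stable a f g R (u a) (v a)) (Rel⊑-split R _ _ r a)

proposition5 : (F : Functor) (A : Set)
    (O : A → Order (Functor.raw F)) (P : Order (Exp F A)) →
    (∀ {X : Set} (α β : A → Functor.F₀ F X) →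
      (Order._⊑_ P α β → ∀ a → Order._⊑_ (O a) (α a) (β a)) ×
      ((∀ a → Order._⊑_ (O a) (α a) (β a)) → Order._⊑_ P α β)) →
    (∀ a → Stable (O a)) →
    Stable P
proposition5 = stable-product
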